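{- Let $2\le k<\omega$ and write $\mathbb A$ for $\mathbb A_k$. Let $\xi=\lambda+b<\varepsilon_0$ with $\lambda$ a limit ordinal and $b<\omega$, and put $\lfloor\xi\rfloor_k=\lambda[\mathbb A^{(k-1)}(\xi)]$. If $\zeta$ is an ordinal with $\lfloor\xi\rfloor_k<\zeta<\lambda$, then $\mathbb A(\zeta)>\mathbb A(\xi)$.
   Context: Ordinals: $\varepsilon_0$ is the least ordinal $\varepsilon$ with $\omega^\varepsilon=\varepsilon$. Every $0<\xi<\varepsilon_0$ has a unique $\omega$-normal form $\xi=\omega^{\alpha}b+\gamma$ with $\alpha<\xi$, $b$ a positive natural number, $\gamma<\omega^\alpha$. $\mathrm{coeffs}(0)=\{0\}$, $\mathrm{coeffs}(\omega^\alpha b+\gamma)=\mathrm{coeffs}(\alpha)\cup\mathrm{coeffs}(\gamma)\cup\{b\}$, $\mathrm{mc}(\xi)=\max\mathrm{coeffs}(\xi)$. Fundamental sequences: $0[n]=1[n]=0$; $(\omega^\alpha b+\gamma)[n]=\omega^\alpha b+\gamma[n]$ if $\gamma>0$; $\omega^{\alpha+1}[n]=\omega^\alpha n$; $(\omega^\alpha(b+1))[n]=\omega^\alpha b+(\omega^\alpha)[n]$ if $b>0$; $(\omega^\alpha)[n]=\omega^{\alpha[n]}$ if $\alpha$ is a limit. For $2\le k<\omega$, $\mathbb A_k:\varepsilon_0\to\mathbb N$: $\mathbb A_k(\xi)=\xi+1$ if $\xi<\omega$; if $\xi\ge\omega$, write $\xi=\alpha+b$ with $\alpha$ a limit, $b<\omega$;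 $\mathbb A_k^{(0)}(\xi)=\mathbb A_k(\xi-1)$ if $b>0$, $=\mathrm{mc}(\xi)$ if $b=0$; $\mathbb A_k^{(i+1)}(\xi)=\mathbb A_k(\alpha[\mathbb A_k^{(i)}(\xi)])$; $\mathbb A_k(\xi)=\mathbb A_k^{(k)}(\xi)$. -}

module Defs where

open import Data.Nat using (ℕ; zero; suc; _+_; _∸_; _⊔_; _≤_; _<_)
open import Data.Bool using (Bool; true; false; if_then_else_)
open import Relation.Binary.PropositionalEquality using (_≡_; _≢_)
open import Relation.Nullary using (¬_)

-- Ordinals below ε₀ as Cantor (ω-)normal-form terms.
-- ω^ α · b + γ  represents  ω^α·b + γ.

data OT : Set where
  𝟎      : OT
  ω^_·_+_ : OT → ℕ → OT → OT

infixl 6 ω^_·_+_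

-- Ordering of terms (lexicographic; correct on normal forms).
infix 4 _<ₒ_
data _<ₒ_ : OT → OT → Set where
  <-zero : ∀ {a b c} → 𝟎 <ₒ ω^ a · b + c
  <-exp  : ∀ {a b c a' b' c'} → a <ₒ a' → ω^ a · b + c <ₒ ω^ a' · b' + c'
  <-coef : ∀ {a b c b' c'} → b < b' → ω^ a · b + c <ₒ ω^ a · b' + c'
  <-tail : ∀ {a b c c'} → c <ₒ c' → ω^ a · b + c <ₒ ω^ a · b + c'

data NF : OT → Set where
  nf-zero : NF 𝟎
  nf-ω    : ∀ {a b c} → NF a → NF c → 1 ≤ b → c <ₒ ω^ a · 1 + 𝟎 →
            NF (ω^ a · b + c)

𝟏 : OT
𝟏 = ω^ 𝟎 · 1 + 𝟎

data IsSucc : OT → Set where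
  succ-last : ∀ {b} → IsSucc (ω^ 𝟎 · b + 𝟎)
  succ-tail : ∀ {a b c} → IsSucc c → IsSucc (ω^ a · b + c)

record IsLimit (λ' : OT) : Set where
  field
    nonzero : λ' ≢ 𝟎
    notSucc : ¬ IsSucc λ'

_+ℕ_ : OT → ℕ → OT
𝟎 +ℕ zero = 𝟎
𝟎 +ℕ suc n = ω^ 𝟎 · suc n + 𝟎
(ω^ 𝟎 · c + g) +ℕ n = ω^ 𝟎 · (c + n) + g
(ω^ (ω^ a' · b' + c') · c + g) +ℕ n = ω^ (ω^ a' · b' + c') · c + (g +ℕ n)

isFinite : OT → Bool
isFinite 𝟎 = true
isFinite (ω^ 𝟎 · b + c) = true
isFinite (ω^ (ω^ _ · _ + _) · b + c) = false

toℕ : OT → ℕ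
toℕ 𝟎 = 0
toℕ (ω^ 𝟎 · b + c) = b
toℕ (ω^ (ω^ _ · _ + _) · b + c) = 0

-- decomposition ξ = α + b with α limit (or 0), b < ω
finPart : OT → ℕ
finPart 𝟎 = 0
finPart (ω^ 𝟎 · b + 𝟎) = b
finPart (ω^ (ω^ _ · _ + _) · b + 𝟎) = 0
finPart (ω^ a · b + (ω^ a' · b' + c')) = finPart (ω^ a' · b' + c')

limPart : OT → OT
limPart 𝟎 = 𝟎
limPart (ω^ 𝟎 · b + 𝟎) = 𝟎
limPart (ω^ (ω^ a' · b' + c') · b + 𝟎) = ω^ (ω^ a' · b' + c') · b + 𝟎
limPart (ω^ a · b + (ω^ a' · b' + c')) = ω^ a · b + limPart (ω^ a' · b' + c')

pred : OT → OT
pred 𝟎 = 𝟎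
pred (ω^ 𝟎 · zero + 𝟎) = 𝟎
pred (ω^ 𝟎 · suc zero + 𝟎) = 𝟎
pred (ω^ 𝟎 · suc (suc b) + 𝟎) = ω^ 𝟎 · suc b + 𝟎
pred (ω^ (ω^ a' · b' + c') · b + 𝟎) = ω^ (ω^ a' · b' + c') · b + 𝟎
pred (ω^ a · b + (ω^ a' · b' + c')) = ω^ a · b + pred (ω^ a' · b' + c')

mc : OT → ℕ
mc 𝟎 = 0
mc (ω^ a · b + c) = mc a ⊔ mc c ⊔ b

ω^·ℕ : OT → ℕ → OT
ω^·ℕ a zero = 𝟎
ω^·ℕ a (suc n) = ω^ a · suc n + 𝟎

isLastExpZero : OT → Bool
isLastExpZero 𝟎 = false
isLastExpZero (ω^ 𝟎 · b + 𝟎) = true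
isLastExpZero (ω^ (ω^ _ · _ + _) · b + 𝟎) = false
isLastExpZero (ω^ a · b + (ω^ a' · b' + c')) = isLastExpZero (ω^ a' · b' + c')

mutual
  fs : OT → ℕ → OT
  fs 𝟎 n = 𝟎
  fs (ω^ a · b + (ω^ a' · b' + c')) n = ω^ a · b + fs (ω^ a' · b' + c') n
  fs (ω^ a · zero + 𝟎) n = 𝟎                       -- not a normal form
  fs (ω^ a · suc zero + 𝟎) n = fsω a n
  fs (ω^ a · suc (suc b) + 𝟎) n = ω^ a · suc b + fsω a n

  -- (ω^α)[n]:  ω^0[n] = 1[n] = 0;  ω^(α+1)[n] = ω^α n;  ω^α[n] = ω^(α[n]) for α limit
  fsω : OT → ℕ → OT
  fsω 𝟎 n = 𝟎
  fsω (ω^ a · b + c) n =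
    if isLastExpZero (ω^ a · b + c)
    then ω^·ℕ (pred (ω^ a · b + c)) n
    else ω^ (fs (ω^ a · b + c) n) · 1 + 𝟎

-- The function 𝔸_k, given by its (inductively defined) graph.
--   A k ξ m     :  𝔸_k(ξ) = m
--   Aᵢ k i ξ m  :  𝔸_k^{(i)}(ξ) = m   (for ξ ≥ ω)

mutual
  data A (k : ℕ) : OT → ℕ → Set where
    A-fin : ∀ {ξ} → isFinite ξ ≡ true → A k ξ (suc (toℕ ξ))
    A-inf : ∀ {ξ m} → isFinite ξ ≡ false → Aᵢ k k ξ m → A k ξ m

  data Aᵢ (k : ℕ) : ℕ → OT → ℕ → Set where
    A⁰-succ : ∀ {ξ m} → 1 ≤ finPart ξ → A k (pred ξ) m → Aᵢ k 0 ξ m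
    A⁰-lim  : ∀ {ξ} → finPart ξ ≡ 0 → Aᵢ k 0 ξ (mc ξ)
    Aˢ      : ∀ {i ξ m m'} → Aᵢ k i ξ m → A k (fs (limPart ξ) m) m' →
              Aᵢ k (suc i) ξ m'

-- 𝔸(ξ) = 𝔸^{(k)}(ξ) = 𝔸(λ[j]) with j = 𝔸^{(k-1)}(ξ), so it suffices that 𝔸(λ[n]) < 𝔸(ζ)
-- whenever λ[n] < ζ < λ, which is proved by induction on the computation of 𝔸(ζ). For a successor ζ we have 𝔸(ζ) ≥ 𝔸^{(0)}(ζ) = 𝔸(ζ - 1),
-- since the iterates increase (x ≤ mc(μ[x]) < 𝔸(μ[x])), and ζ - 1 is either λ[n] or again
-- strictly between λ[n] and λ. For a limit ζ, 𝔸(ζ) = 𝔸(ζ[J]) with J = 𝔸^{(k-1)}(ζ) ≥ 2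
-- (this is where k ≥ 2 is needed), and the Bachmann property of the fundamental sequences
-- keeps ζ[J] strictly between λ[n] and λ.

module Submission where

open import Defs
open import Data.Nat using (ℕ; zero; suc; _+_; _≤_; _<_; _∸_; _⊔_; z≤n; s≤s)
import Data.Nat.Properties as ℕ
open import Data.Bool using (true; false)
open import Data.Sum using (_⊎_; inj₁; inj₂)
import Data.Sum as Sum
open import Data.Product using (_×_; _,_; ∃-syntax)
open import Data.Empty using (⊥-elim)
open import Relation.Nullary using (¬_)
open import Relation.Binary.PropositionalEquality using (_≡_; refl; sym; trans; cong; subst)

infix 4 _≤ₒ_
_≤ₒ_ : OT → OT → Set
x ≤ₒ y = x ≡ y ⊎ x <ₒ y

<ₒ-trans : ∀ {x y z} → x <ₒ y → y <ₒ z → x <ₒ z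
<ₒ-trans <-zero     (<-exp _)  = <-zero
<ₒ-trans <-zero     (<-coef _) = <-zero
<ₒ-trans <-zero     (<-tail _) = <-zero
<ₒ-trans (<-exp p)  (<-exp q)  = <-exp (<ₒ-trans p q)
<ₒ-trans (<-exp p)  (<-coef _) = <-exp p
<ₒ-trans (<-exp p)  (<-tail _) = <-exp p
<ₒ-trans (<-coef _) (<-exp q)  = <-exp q
<ₒ-trans (<-coef p) (<-coef q) = <-coef (ℕ.<-trans p q)
<ₒ-trans (<-coef p) (<-tail _) = <-coef p
<ₒ-trans (<-tail _) (<-exp q)  = <-exp q
<ₒ-trans (<-tail _) (<-coef q) = <-coef q
<ₒ-trans (<-tail p) (<-tail q) = <-tail (<ₒ-trans p q)

<ₒ-irrefl : ∀ {x} → ¬ x <ₒ x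
<ₒ-irrefl (<-exp p)  = <ₒ-irrefl p
<ₒ-irrefl (<-coef p) = ℕ.<-irrefl refl p
<ₒ-irrefl (<-tail p) = <ₒ-irrefl p

<ₒ-asym : ∀ {x y} → x <ₒ y → ¬ y <ₒ x
<ₒ-asym p q = <ₒ-irrefl (<ₒ-trans p q)

≤ₒ-<ₒ-trans : ∀ {x y z} → x ≤ₒ y → y <ₒ z → x <ₒ z
≤ₒ-<ₒ-trans (inj₁ refl) q = q
≤ₒ-<ₒ-trans (inj₂ p)    q = <ₒ-trans p q

<ₒ⇒𝟎<ₒ : ∀ {x y} → x <ₒ y → 𝟎 <ₒ y
<ₒ⇒𝟎<ₒ <-zero     = <-zero
<ₒ⇒𝟎<ₒ (<-exp _)  = <-zero
<ₒ⇒𝟎<ₒ (<-coef _) = <-zero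
<ₒ⇒𝟎<ₒ (<-tail _) = <-zero

≤ₒ-tail : ∀ {a b u v} → u ≤ₒ v → ω^ a · b + u ≤ₒ ω^ a · b + v
≤ₒ-tail (inj₁ refl) = inj₁ refl
≤ₒ-tail (inj₂ u<v)  = inj₂ (<-tail u<v)

<ₒ𝟏⇒≡𝟎 : ∀ {c} → NF c → c <ₒ 𝟏 → c ≡ 𝟎
<ₒ𝟏⇒≡𝟎 _               <-zero             = refl
<ₒ𝟏⇒≡𝟎 (nf-ω _ _ () _) (<-coef (s≤s z≤n))

<ₒω^⇒exponent-<ₒ : ∀ {x y z e} → NF (ω^ x · y + z) → ω^ x · y + z <ₒ ω^ e · 1 + 𝟎 → x <ₒ e
<ₒω^⇒exponent-<ₒ _               (<-exp p)          = p
<ₒω^⇒exponent-<ₒ (nf-ω _ _ () _) (<-coef (s≤s z≤n))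

NF-ω^·1≤ₒ : ∀ {x y z} → NF (ω^ x · y + z) → ω^ x · 1 + 𝟎 ≤ₒ ω^ x · y + z
NF-ω^·1≤ₒ {y = suc zero}    {z = 𝟎}            _               = inj₁ refl
NF-ω^·1≤ₒ {y = suc zero}    {z = ω^ _ · _ + _} _               = inj₂ (<-tail <-zero)
NF-ω^·1≤ₒ {y = suc (suc _)}                    _               = inj₂ (<-coef (s≤s (s≤s z≤n)))
NF-ω^·1≤ₒ {y = zero}                           (nf-ω _ _ () _)

NF-exponent : ∀ {a b c} → NF (ω^ a · b + c) → NF a
NF-exponent (nf-ω na _ _ _) = na

NF-tail : ∀ {a b c} → NF (ω^ a · b + c) → NF c
NF-tail (nf-ω _ nc _ _) = nc

data Limit : OT → Set where
  limit-ω    : ∀ {a b c d} → Limit (ω^ (ω^ a · b + c) · d + 𝟎)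
  limit-tail : ∀ {a b c} → Limit c → Limit (ω^ a · b + c)

Limit⇒𝟎<ₒ : ∀ {μ} → Limit μ → 𝟎 <ₒ μ
Limit⇒𝟎<ₒ limit-ω        = <-zero
Limit⇒𝟎<ₒ (limit-tail _) = <-zero

Limit-exponent : ∀ {x y} → Limit (ω^ x · y + 𝟎) → 𝟎 <ₒ x
Limit-exponent limit-ω = <-zero

Limit-tail : ∀ {x y z} → Limit (ω^ x · y + z) → 𝟎 <ₒ z → Limit z
Limit-tail (limit-tail l) _ = l

successor-or-limit : ∀ {a b c} → IsSucc (ω^ a · b + c) ⊎ Limit (ω^ a · b + c)
successor-or-limit {𝟎}            {c = 𝟎}            = inj₁ succ-last
successor-or-limit {ω^ _ · _ + _} {c = 𝟎}            = inj₂ limit-ω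
successor-or-limit                {c = ω^ _ · _ + _} = Sum.map succ-tail limit-tail successor-or-limit

IsLimit⇒Limit : ∀ {μ} → IsLimit μ → Limit μ
IsLimit⇒Limit {𝟎}            l = ⊥-elim (IsLimit.nonzero l refl)
IsLimit⇒Limit {ω^ _ · _ + _} l with successor-or-limit
... | inj₁ s  = ⊥-elim (IsLimit.notSucc l s)
... | inj₂ l′ = l′

NF-ω^𝟎-¬Limit : ∀ {b c} → NF (ω^ 𝟎 · b + c) → ¬ Limit (ω^ 𝟎 · b + c)
NF-ω^𝟎-¬Limit (nf-ω _ nc _ c<1) (limit-tail l) with <ₒ𝟏⇒≡𝟎 nc c<1
NF-ω^𝟎-¬Limit _ (limit-tail ()) | refl

Limit⇒infinite : ∀ {μ} → NF μ → Limit μ → isFinite μ ≡ false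
Limit⇒infinite {ω^ 𝟎 · _ + _}              nf l = ⊥-elim (NF-ω^𝟎-¬Limit nf l)
Limit⇒infinite {ω^ (ω^ _ · _ + _) · _ + _} _  _ = refl

infinite⇒𝟎<ₒ : ∀ {ζ} → isFinite ζ ≡ false → 𝟎 <ₒ ζ
infinite⇒𝟎<ₒ {ω^ _ · _ + _} _ = <-zero

isLastExpZero-tail : ∀ a b {x y z} → isLastExpZero (ω^ a · b + (ω^ x · y + z)) ≡ isLastExpZero (ω^ x · y + z)
isLastExpZero-tail 𝟎              _ = refl
isLastExpZero-tail (ω^ _ · _ + _) _ = refl

isLastExpZero-succ : ∀ {e} → IsSucc e → isLastExpZero e ≡ true
isLastExpZero-succ succ-last                           = refl
isLastExpZero-succ (succ-tail {a} {b} {ω^ _ · _ + _} s) = trans (isLastExpZero-tail a b) (isLastExpZero-succ s)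

isLastExpZero-limit : ∀ {e} → Limit e → isLastExpZero e ≡ false
isLastExpZero-limit limit-ω                             = refl
isLastExpZero-limit (limit-tail {a} {b} {ω^ _ · _ + _} l) = trans (isLastExpZero-tail a b) (isLastExpZero-limit l)

pred-tail : ∀ a b {x y z} → pred (ω^ a · b + (ω^ x · y + z)) ≡ ω^ a · b + pred (ω^ x · y + z)
pred-tail 𝟎              zero          = refl
pred-tail 𝟎              (suc zero)    = refl
pred-tail 𝟎              (suc (suc _)) = refl
pred-tail (ω^ _ · _ + _) _             = refl

pred-≤ₒ : ∀ t → pred t ≤ₒ t
pred-≤ₒ 𝟎                           = inj₁ refl
pred-≤ₒ (ω^ 𝟎 · zero + 𝟎)           = inj₂ <-zero
pred-≤ₒ (ω^ 𝟎 · suc zero + 𝟎)       = inj₂ <-zero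
pred-≤ₒ (ω^ 𝟎 · suc (suc _) + 𝟎)    = inj₂ (<-coef (ℕ.n<1+n _))
pred-≤ₒ (ω^ (ω^ _ · _ + _) · _ + 𝟎) = inj₁ refl
pred-≤ₒ (ω^ a · b + (ω^ x · y + z)) =
  subst (λ p → p ≤ₒ ω^ a · b + (ω^ x · y + z)) (sym (pred-tail a b)) (≤ₒ-tail (pred-≤ₒ (ω^ x · y + z)))

pred-<ₒ : ∀ {y} → IsSucc y → pred y <ₒ y
pred-<ₒ (succ-last {zero})        = <-zero
pred-<ₒ (succ-last {suc zero})    = <-zero
pred-<ₒ (succ-last {suc (suc _)}) = <-coef (ℕ.n<1+n _)
pred-<ₒ (succ-tail {a} {b} {ω^ x · y + z} s) rewrite pred-tail a b {x} {y} {z} = <-tail (pred-<ₒ s)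

pred-NF : ∀ {y} → NF y → NF (pred y)
pred-NF {𝟎}                         nf = nf
pred-NF {ω^ 𝟎 · suc zero + 𝟎}       _  = nf-zero
pred-NF {ω^ 𝟎 · suc (suc _) + 𝟎}    _  = nf-ω nf-zero nf-zero (s≤s z≤n) <-zero
pred-NF {ω^ (ω^ _ · _ + _) · _ + 𝟎} nf = nf
pred-NF {ω^ a · b + (ω^ x · y + z)} (nf-ω na nc hb hc) rewrite pred-tail a b {x} {y} {z} =
  nf-ω na (pred-NF nc) hb (≤ₒ-<ₒ-trans (pred-≤ₒ _) hc)

<ₒ⇒≤ₒpred : ∀ {x y} → NF x → IsSucc y → x <ₒ y → x ≤ₒ pred y
<ₒ⇒≤ₒpred _                 (succ-last {zero})        <-zero = inj₁ refl
<ₒ⇒≤ₒpred _                 (succ-last {suc zero})    <-zero = inj₁ refl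
<ₒ⇒≤ₒpred _                 (succ-last {suc (suc _)}) <-zero = inj₂ <-zero
<ₒ⇒≤ₒpred (nf-ω _ _ () _)   (succ-last {suc zero})    (<-coef (s≤s z≤n))
<ₒ⇒≤ₒpred (nf-ω _ nc _ c<1) (succ-last {suc (suc _)}) (<-coef (s≤s b≤))
  with <ₒ𝟏⇒≡𝟎 nc c<1 | ℕ.m≤n⇒m<n∨m≡n b≤
... | refl | inj₁ b<   = inj₂ (<-coef b<)
... | refl | inj₂ refl = inj₁ refl
<ₒ⇒≤ₒpred nfx (succ-tail {a} {b} {c@(ω^ _ · _ + _)} s) x<y =
  subst (_ ≤ₒ_) (sym (pred-tail a b)) (below-tail nfx x<y)
  where
  below-tail : ∀ {x} → NF x → x <ₒ ω^ a · b + c → x ≤ₒ ω^ a · b + pred c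
  below-tail _               <-zero     = inj₂ <-zero
  below-tail _               (<-exp p)  = inj₂ (<-exp p)
  below-tail _               (<-coef p) = inj₂ (<-coef p)
  below-tail (nf-ω _ nc _ _) (<-tail p) = ≤ₒ-tail (<ₒ⇒≤ₒpred nc s p)

limPart-tail : ∀ a b {x y z} → limPart (ω^ a · b + (ω^ x · y + z)) ≡ ω^ a · b + limPart (ω^ x · y + z)
limPart-tail 𝟎              _ = refl
limPart-tail (ω^ _ · _ + _) _ = refl

finPart-tail : ∀ a b {x y z} → finPart (ω^ a · b + (ω^ x · y + z)) ≡ finPart (ω^ x · y + z)
finPart-tail 𝟎              _ = refl
finPart-tail (ω^ _ · _ + _) _ = refl

limPart-≤ₒ : ∀ t → limPart t ≤ₒ t
limPart-≤ₒ 𝟎                           = inj₁ refl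
limPart-≤ₒ (ω^ 𝟎 · _ + 𝟎)              = inj₂ <-zero
limPart-≤ₒ (ω^ (ω^ _ · _ + _) · _ + 𝟎) = inj₁ refl
limPart-≤ₒ (ω^ a · b + (ω^ x · y + z)) =
  subst (λ l → l ≤ₒ ω^ a · b + (ω^ x · y + z)) (sym (limPart-tail a b)) (≤ₒ-tail (limPart-≤ₒ (ω^ x · y + z)))

limPart-NF : ∀ {ζ} → NF ζ → NF (limPart ζ)
limPart-NF {𝟎}                         nf = nf
limPart-NF {ω^ 𝟎 · _ + 𝟎}              _  = nf-zero
limPart-NF {ω^ (ω^ _ · _ + _) · _ + 𝟎} nf = nf
limPart-NF {ω^ a · b + (ω^ x · y + z)} (nf-ω na nc hb hc) rewrite limPart-tail a b {x} {y} {z} =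
  nf-ω na (limPart-NF nc) hb (≤ₒ-<ₒ-trans (limPart-≤ₒ _) hc)

limPart-finite : ∀ {t} → NF t → isFinite t ≡ true → limPart t ≡ 𝟎
limPart-finite {𝟎}                         _                 _ = refl
limPart-finite {ω^ 𝟎 · _ + 𝟎}              _                 _ = refl
limPart-finite {ω^ 𝟎 · _ + (ω^ _ · _ + _)} (nf-ω _ nc _ c<1) _ with <ₒ𝟏⇒≡𝟎 nc c<1
... | ()

limPart-Limit : ∀ {ζ} → NF ζ → isFinite ζ ≡ false → Limit (limPart ζ)
limPart-Limit {ω^ (ω^ _ · _ + _) · _ + 𝟎}              _               _ = limit-ω
limPart-Limit {ω^ (ω^ _ · _ + _) · _ + (ω^ x · y + z)} (nf-ω _ nc _ _) _ with isFinite (ω^ x · y + z) in fin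
... | true  rewrite limPart-finite nc fin = limit-ω
... | false = limit-tail (limPart-Limit nc fin)

limPart≡self : ∀ {ζ} → NF ζ → finPart ζ ≡ 0 → limPart ζ ≡ ζ
limPart≡self {𝟎}                         _                 _    = refl
limPart≡self {ω^ 𝟎 · _ + 𝟎}              (nf-ω _ _ () _)   refl
limPart≡self {ω^ (ω^ _ · _ + _) · _ + 𝟎} _                 _    = refl
limPart≡self {ω^ 𝟎 · _ + (ω^ _ · _ + _)} (nf-ω _ nc _ c<1) _    with <ₒ𝟏⇒≡𝟎 nc c<1
... | ()
limPart≡self {ω^ e@(ω^ _ · _ + _) · b + (ω^ _ · _ + _)} (nf-ω _ nc _ _) fp =
  cong (ω^ e · b +_) (limPart≡self nc fp)

finPart-suc⇒IsSucc : ∀ ζ {r} → finPart ζ ≡ suc r → IsSucc ζ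
finPart-suc⇒IsSucc (ω^ 𝟎 · _ + 𝟎)              _  = succ-last
finPart-suc⇒IsSucc (ω^ a · b + (ω^ x · y + z)) fp =
  succ-tail (finPart-suc⇒IsSucc (ω^ x · y + z) (trans (sym (finPart-tail a b)) fp))

isFinite-+ℕ : ∀ L b → isFinite (L +ℕ b) ≡ isFinite L
isFinite-+ℕ 𝟎                           zero    = refl
isFinite-+ℕ 𝟎                           (suc _) = refl
isFinite-+ℕ (ω^ 𝟎 · _ + _)              _       = refl
isFinite-+ℕ (ω^ (ω^ _ · _ + _) · _ + _) _       = refl

limPart-+ℕ : ∀ {L} → NF L → Limit L → ∀ b → limPart (L +ℕ b) ≡ L
limPart-+ℕ _  limit-ω zero    = refl
limPart-+ℕ _  limit-ω (suc _) = refl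
limPart-+ℕ {ω^ 𝟎 · _ + _} nf l _ = ⊥-elim (NF-ω^𝟎-¬Limit nf l)
limPart-+ℕ {ω^ (ω^ _ · _ + _) · _ + (ω^ 𝟎 · _ + _)} (nf-ω _ nc _ _) (limit-tail l) _ = ⊥-elim (NF-ω^𝟎-¬Limit nc l)
limPart-+ℕ {ω^ e@(ω^ _ · _ + _) · d + (ω^ (ω^ _ · _ + _) · _ + _)} (nf-ω _ nc _ _) (limit-tail l) b =
  cong (ω^ e · d +_) (limPart-+ℕ nc l b)

finite-below : ∀ {x ζ} → NF ζ → isFinite ζ ≡ true → x <ₒ ζ → isFinite x ≡ true × toℕ x < toℕ ζ
finite-below {ζ = ω^ 𝟎 · _ + c} (nf-ω _ nc hb c<1) _ x<ζ with <ₒ𝟏⇒≡𝟎 nc c<1 | x<ζ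
... | refl | <-zero   = refl , hb
... | refl | <-coef p = refl , p

fsω-succ : ∀ {e} → IsSucc e → ∀ n → fsω e n ≡ ω^·ℕ (pred e) n
fsω-succ succ-last       _ = refl
fsω-succ s@(succ-tail _) _ rewrite isLastExpZero-succ s = refl

fsω-limit : ∀ {e} → Limit e → ∀ n → fsω e n ≡ ω^ (fs e n) · 1 + 𝟎
fsω-limit limit-ω          _ = refl
fsω-limit l@(limit-tail _) _ rewrite isLastExpZero-limit l = refl

-- fsω tests the Boolean isLastExpZero; this turns that test into the successor/limit split.
fsω-cases : ∀ (P : OT → Set) {e} n → 𝟎 <ₒ e →
            (IsSucc e → P (ω^·ℕ (pred e) n)) → (Limit e → P (ω^ (fs e n) · 1 + 𝟎)) → P (fsω e n)
fsω-cases P {ω^ _ · _ + _} n _ succ-case limit-case with successor-or-limit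
... | inj₁ s = subst P (sym (fsω-succ s n)) (succ-case s)
... | inj₂ l = subst P (sym (fsω-limit l n)) (limit-case l)

ω^·ℕ-<ₒ : ∀ {x a} n → x <ₒ a → ω^·ℕ x n <ₒ ω^ a · 1 + 𝟎
ω^·ℕ-<ₒ zero    _   = <-zero
ω^·ℕ-<ₒ (suc _) x<a = <-exp x<a

ω^·ℕ-NF : ∀ {x} → NF x → ∀ n → NF (ω^·ℕ x n)
ω^·ℕ-NF _  zero    = nf-zero
ω^·ℕ-NF nx (suc _) = nf-ω nx nf-zero (s≤s z≤n) <-zero

mutual
  fs-<ₒ : ∀ {c n} → NF c → 𝟎 <ₒ c → fs c n <ₒ c
  fs-<ₒ {ω^ _ · _ + (ω^ _ · _ + _)} (nf-ω _ nc _ _) _ = <-tail (fs-<ₒ nc <-zero)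
  fs-<ₒ {ω^ _ · suc zero + 𝟎}       (nf-ω na _ _ _) _ = fsω-<ₒ na
  fs-<ₒ {ω^ _ · suc (suc _) + 𝟎}    _               _ = <-coef (ℕ.n<1+n _)
  fs-<ₒ {ω^ _ · zero + 𝟎}           (nf-ω _ _ () _)

  fsω-<ₒ : ∀ {a n} → NF a → fsω a n <ₒ ω^ a · 1 + 𝟎
  fsω-<ₒ {𝟎}                    _  = <-zero
  fsω-<ₒ {a@(ω^ _ · _ + _)} {n} na =
    fsω-cases (_<ₒ ω^ a · 1 + 𝟎) n <-zero (λ s → ω^·ℕ-<ₒ n (pred-<ₒ s)) (λ _ → <-exp (fs-<ₒ na <-zero))

mutual
  fs-NF : ∀ {α n} → NF α → NF (fs α n)
  fs-NF {𝟎}                         nf                 = nf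
  fs-NF {ω^ _ · _ + (ω^ _ · _ + _)} (nf-ω na nc hb hc) = nf-ω na (fs-NF nc) hb (<ₒ-trans (fs-<ₒ nc <-zero) hc)
  fs-NF {ω^ _ · suc zero + 𝟎}       (nf-ω na _ _ _)    = fsω-NF na
  fs-NF {ω^ _ · suc (suc _) + 𝟎}    (nf-ω na _ _ _)    = nf-ω na (fsω-NF na) (s≤s z≤n) (fsω-<ₒ na)
  fs-NF {ω^ _ · zero + 𝟎}           (nf-ω _ _ () _)

  fsω-NF : ∀ {a n} → NF a → NF (fsω a n)
  fsω-NF {𝟎}                _  = nf-zero
  fsω-NF {ω^ _ · _ + _} {n} na =
    fsω-cases NF n <-zero (λ _ → ω^·ℕ-NF (pred-NF na) n) (λ _ → nf-ω (fs-NF na) nf-zero (s≤s z≤n) <-zero)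

fsω-pos : ∀ {e m} → 𝟎 <ₒ e → 1 ≤ m → 𝟎 <ₒ fsω e m
fsω-pos {m = suc m} 𝟎<e _ = fsω-cases (𝟎 <ₒ_) (suc m) 𝟎<e (λ _ → <-zero) (λ _ → <-zero)

fs-pos : ∀ {μ m} → NF μ → Limit μ → 1 ≤ m → 𝟎 <ₒ fs μ m
fs-pos _               (limit-ω {d = suc zero})          1≤m = fsω-pos <-zero 1≤m
fs-pos _               (limit-ω {d = suc (suc _)})       _   = <-zero
fs-pos (nf-ω _ _ () _) (limit-ω {d = zero})
fs-pos _               (limit-tail {c = ω^ _ · _ + _} _) _   = <-zero

mc-exponent-≤ : ∀ a b c → mc a ≤ mc (ω^ a · b + c)
mc-exponent-≤ a b c = ℕ.≤-trans (ℕ.m≤m⊔n (mc a) (mc c)) (ℕ.m≤m⊔n _ b)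

mc-tail-≤ : ∀ a b c → mc c ≤ mc (ω^ a · b + c)
mc-tail-≤ a b c = ℕ.≤-trans (ℕ.m≤n⊔m (mc a) (mc c)) (ℕ.m≤m⊔n _ b)

mc-coef-≤ : ∀ a b c → b ≤ mc (ω^ a · b + c)
mc-coef-≤ a b c = ℕ.m≤n⊔m (mc a ⊔ mc c) b

mc-ω^·ℕ : ∀ {y} n → n ≤ mc (ω^·ℕ y n)
mc-ω^·ℕ     zero    = z≤n
mc-ω^·ℕ {y} (suc n) = mc-coef-≤ y (suc n) 𝟎

mutual
  mc-fs : ∀ {μ x} → NF μ → Limit μ → x ≤ mc (fs μ x)
  mc-fs         (nf-ω ne _ _ _) (limit-ω {d = suc zero})            = mc-fsω ne <-zero
  mc-fs {x = x} (nf-ω ne _ _ _) (limit-ω {a} {b} {c} {suc (suc d)}) =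
    ℕ.≤-trans (mc-fsω ne <-zero) (mc-tail-≤ (ω^ a · b + c) (suc d) (fsω (ω^ a · b + c) x))
  mc-fs         (nf-ω _ _ () _) (limit-ω {d = zero})
  mc-fs {x = x} (nf-ω _ nc _ _) (limit-tail {a} {b} {c@(ω^ _ · _ + _)} l) =
    ℕ.≤-trans (mc-fs nc l) (mc-tail-≤ a b (fs c x))

  mc-fsω : ∀ {e x} → NF e → 𝟎 <ₒ e → x ≤ mc (fsω e x)
  mc-fsω {e} {x} ne 𝟎<e =
    fsω-cases (λ o → x ≤ mc o) x 𝟎<e (λ _ → mc-ω^·ℕ x) (λ l → ℕ.≤-trans (mc-fs ne l) (mc-exponent-≤ (fs e x) 1 𝟎))

mc-pred : ∀ α → mc α ≤ suc (mc (pred α))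
mc-pred 𝟎                           = z≤n
mc-pred (ω^ 𝟎 · zero + 𝟎)           = z≤n
mc-pred (ω^ 𝟎 · suc zero + 𝟎)       = s≤s z≤n
mc-pred (ω^ 𝟎 · suc (suc _) + 𝟎)    = ℕ.≤-refl
mc-pred (ω^ (ω^ _ · _ + _) · _ + 𝟎) = ℕ.n≤1+n _
mc-pred (ω^ a · b + (ω^ x · y + z)) =
  subst (λ p → mc (ω^ a · b + (ω^ x · y + z)) ≤ suc (mc p)) (sym (pred-tail a b))
    (ℕ.⊔-mono-≤ (ℕ.⊔-mono-≤ (ℕ.n≤1+n (mc a)) (mc-pred (ω^ x · y + z))) (ℕ.n≤1+n b))

mc-pos : ∀ {ζ} → NF ζ → 𝟎 <ₒ ζ → 1 ≤ mc ζ
mc-pos {ω^ a · b + c} (nf-ω _ _ 1≤b _) _ = ℕ.≤-trans 1≤b (mc-coef-≤ a b c)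

ω^·-<ₒ-fs : ∀ {x y z k m} → NF (ω^ x · y + z) → Limit (ω^ x · y + z) → 1 ≤ m →
            ω^ x · suc k + 𝟎 <ₒ ω^ x · y + z → ω^ x · suc k + 𝟎 <ₒ fs (ω^ x · y + z) m
ω^·-<ₒ-fs                                _  _ _   (<-exp p)  = ⊥-elim (<ₒ-irrefl p)
ω^·-<ₒ-fs                 {z = ω^ _ · _ + _} _  _ _   (<-coef p) = <-coef p
ω^·-<ₒ-fs                 {z = ω^ _ · _ + _} nf l 1≤m (<-tail _) = <-tail (fs-pos (NF-tail nf) (Limit-tail l <-zero) 1≤m)
ω^·-<ₒ-fs {y = suc zero}    {z = 𝟎}          _  _ _   (<-coef (s≤s ()))
ω^·-<ₒ-fs {y = suc (suc _)} {z = 𝟎}          _  l 1≤m (<-coef (s≤s (s≤s k≤y))) with ℕ.m≤n⇒m<n∨m≡n k≤y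
... | inj₁ k<y  = <-coef (s≤s k<y)
... | inj₂ refl = <-tail (fsω-pos (Limit-exponent l) 1≤m)

ω^·1<ₒω^·2+ : ∀ {β γ m} → β ≤ₒ γ → ω^ β · 1 + 𝟎 <ₒ ω^ γ · suc (suc m) + 𝟎
ω^·1<ₒω^·2+ (inj₁ refl) = <-coef (s≤s (s≤s z≤n))
ω^·1<ₒω^·2+ (inj₂ β<γ)  = <-exp β<γ

<ₒ-between-tails : ∀ {a b u v μ} → ω^ a · b + u <ₒ μ → μ <ₒ ω^ a · b + v →
                   ∃[ w ] μ ≡ ω^ a · b + w × u <ₒ w × w <ₒ v
<ₒ-between-tails (<-tail p) (<-tail q) = _ , refl , p , q
<ₒ-between-tails (<-exp p)  (<-exp q)  = ⊥-elim (<ₒ-asym p q)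
<ₒ-between-tails (<-exp p)  (<-coef _) = ⊥-elim (<ₒ-irrefl p)
<ₒ-between-tails (<-exp p)  (<-tail _) = ⊥-elim (<ₒ-irrefl p)
<ₒ-between-tails (<-coef _) (<-exp q)  = ⊥-elim (<ₒ-irrefl q)
<ₒ-between-tails (<-coef p) (<-coef q) = ⊥-elim (ℕ.<-asym p q)
<ₒ-between-tails (<-coef p) (<-tail _) = ⊥-elim (ℕ.<-irrefl refl p)
<ₒ-between-tails (<-tail _) (<-exp q)  = ⊥-elim (<ₒ-irrefl q)
<ₒ-between-tails (<-tail _) (<-coef q) = ⊥-elim (ℕ.<-irrefl refl q)

<ₒ-between-coefs : ∀ {a b u μ} → NF μ → ω^ a · b + u <ₒ μ → μ <ₒ ω^ a · suc b + 𝟎 →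
                   ∃[ w ] μ ≡ ω^ a · b + w × u <ₒ w × w <ₒ ω^ a · 1 + 𝟎
<ₒ-between-coefs (nf-ω _ _ _ w<ω^a) (<-tail p) (<-coef _) = _ , refl , p , w<ω^a
<ₒ-between-coefs _ (<-exp p)  (<-exp q)  = ⊥-elim (<ₒ-asym p q)
<ₒ-between-coefs _ (<-exp p)  (<-coef _) = ⊥-elim (<ₒ-irrefl p)
<ₒ-between-coefs _ (<-coef _) (<-exp q)  = ⊥-elim (<ₒ-irrefl q)
<ₒ-between-coefs _ (<-coef p) (<-coef q) = ⊥-elim (ℕ.<⇒≱ p (ℕ.≤-pred q))
<ₒ-between-coefs _ (<-tail _) (<-exp q)  = ⊥-elim (<ₒ-irrefl q)

-- Strictness needs m ≥ 2: ω^ω[1] = ω = ω²[1].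
mutual
  bachmann : ∀ {L μ n m} → NF L → Limit L → NF μ → Limit μ →
             fs L n <ₒ μ → μ <ₒ L → 2 ≤ m → fs L n <ₒ fs μ m
  bachmann (nf-ω _ nc _ _) (limit-tail {c = ω^ _ · _ + _} lc) nfμ lμ lo hi 2≤m
    with <ₒ-between-tails lo hi
  ... | ω^ _ · _ + _ , refl , lo′ , hi′ =
    <-tail (bachmann nc lc (NF-tail nfμ) (Limit-tail lμ <-zero) lo′ hi′ 2≤m)
  bachmann (nf-ω ne _ _ _) (limit-ω {d = suc zero}) nfμ lμ lo hi 2≤m = bachmann-ω ne <-zero nfμ lμ lo hi 2≤m
  bachmann (nf-ω ne _ _ _) (limit-ω {d = suc (suc _)}) nfμ lμ lo hi 2≤m
    with <ₒ-between-coefs nfμ lo hi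
  ... | ω^ _ · _ + _ , refl , lo′ , hi′ =
    <-tail (bachmann-ω ne <-zero (NF-tail nfμ) (Limit-tail lμ <-zero) lo′ hi′ 2≤m)
  bachmann (nf-ω _ _ () _) (limit-ω {d = zero})

  bachmann-ω : ∀ {e μ n m} → NF e → 𝟎 <ₒ e → NF μ → Limit μ →
               fsω e n <ₒ μ → μ <ₒ ω^ e · 1 + 𝟎 → 2 ≤ m → fsω e n <ₒ fs μ m
  bachmann-ω {e} {μ@(ω^ x · y + z)} {n} {m} ne 𝟎<e nfμ lμ lo hi 2≤m =
    fsω-cases (λ o → o <ₒ μ → o <ₒ fs μ m) n 𝟎<e (successor-case n) limit-case lo
    where
    x<e : x <ₒ e
    x<e = <ₒω^⇒exponent-<ₒ nfμ hi

    1≤m : 1 ≤ m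
    1≤m = ℕ.<⇒≤ 2≤m

    successor-case : ∀ k → IsSucc e → ω^·ℕ (pred e) k <ₒ μ → ω^·ℕ (pred e) k <ₒ fs μ m
    successor-case zero    _ _                = fs-pos nfμ lμ 1≤m
    successor-case (suc _) s (<-exp pred-e<x) =
      ⊥-elim (<ₒ-irrefl (≤ₒ-<ₒ-trans (<ₒ⇒≤ₒpred (NF-exponent nfμ) s x<e) pred-e<x))
    successor-case (suc _) _ lo′@(<-coef _)   = ω^·-<ₒ-fs nfμ lμ 1≤m lo′
    successor-case (suc _) _ lo′@(<-tail _)   = ω^·-<ₒ-fs nfμ lμ 1≤m lo′

    limit-case : Limit e → ω^ (fs e n) · 1 + 𝟎 <ₒ μ → ω^ (fs e n) · 1 + 𝟎 <ₒ fs μ m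
    limit-case le (<-exp e[n]<x) with NF-ω^·1≤ₒ nfμ
    ... | inj₁ refl = ω^fs<ₒfsω ne le (NF-exponent nfμ) e[n]<x x<e 2≤m
    ... | inj₂ lt   = <ₒ-trans (<-exp e[n]<x) (ω^·-<ₒ-fs nfμ lμ 1≤m lt)
    limit-case _ lo′@(<-coef _) = ω^·-<ₒ-fs nfμ lμ 1≤m lo′
    limit-case _ lo′@(<-tail _) = ω^·-<ₒ-fs nfμ lμ 1≤m lo′

  ω^fs<ₒfsω : ∀ {e x n m} → NF e → Limit e → NF x →
              fs e n <ₒ x → x <ₒ e → 2 ≤ m → ω^ (fs e n) · 1 + 𝟎 <ₒ fsω x m
  ω^fs<ₒfsω {e} {x} {n} {suc (suc m)} ne le nx e[n]<x x<e 2≤m =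
    fsω-cases (ω^ fs e n · 1 + 𝟎 <ₒ_) (suc (suc m)) (<ₒ⇒𝟎<ₒ e[n]<x)
      (λ s → ω^·1<ₒω^·2+ (<ₒ⇒≤ₒpred (fs-NF ne) s e[n]<x))
      (λ lx → <-exp (bachmann ne le nx lx e[n]<x x<e 2≤m))
  ω^fs<ₒfsω {m = suc zero} _ _ _ _ _ (s≤s ())

mutual
  A-functional : ∀ {k α y y′} → A k α y → A k α y′ → y ≡ y′
  A-functional (A-fin _)   (A-fin _)   = refl
  A-functional (A-fin f) (A-inf g _) with trans (sym f) g
  ... | ()
  A-functional (A-inf g _) (A-fin f) with trans (sym f) g
  ... | ()
  A-functional (A-inf _ d) (A-inf _ e) = Aᵢ-functional d e

  Aᵢ-functional : ∀ {k i α y y′} → Aᵢ k i α y → Aᵢ k i α y′ → y ≡ y′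
  Aᵢ-functional (A⁰-succ _ d)    (A⁰-succ _ e)    = A-functional d e
  Aᵢ-functional (A⁰-lim _)       (A⁰-lim _)       = refl
  Aᵢ-functional (A⁰-succ 1≤fp _) (A⁰-lim fp≡0)    = ⊥-elim (ℕ.<⇒≢ 1≤fp (sym fp≡0))
  Aᵢ-functional (A⁰-lim fp≡0)    (A⁰-succ 1≤fp _) = ⊥-elim (ℕ.<⇒≢ 1≤fp (sym fp≡0))
  Aᵢ-functional (Aˢ d₁ d₂)       (Aˢ e₁ e₂) with Aᵢ-functional d₁ e₁
  ... | refl = A-functional d₂ e₂

module _ (k : ℕ) where

  mutual
    mc<A : ∀ {α y} → NF α → A (suc k) α y → mc α < y
    mc<A {𝟎}            _                 (A-fin _)             = s≤s z≤n
    mc<A {ω^ 𝟎 · b + _} (nf-ω _ nc _ c<1) (A-fin _)             with <ₒ𝟏⇒≡𝟎 nc c<1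
    ... | refl = ℕ.n<1+n b
    mc<A                nf                (A-inf inf (Aˢ dᵢ d)) = ℕ.≤-<-trans (mc≤Aᵢ nf inf dᵢ) (<A-fs-limPart nf inf d)

    mc≤Aᵢ : ∀ {i α x} → NF α → isFinite α ≡ false → Aᵢ (suc k) i α x → mc α ≤ x
    mc≤Aᵢ {α = α} nf _   (A⁰-succ _ d) = ℕ.≤-trans (mc-pred α) (mc<A (pred-NF nf) d)
    mc≤Aᵢ         _  _   (A⁰-lim _)    = ℕ.≤-refl
    mc≤Aᵢ         nf inf (Aˢ dᵢ d)     = ℕ.<⇒≤ (ℕ.≤-<-trans (mc≤Aᵢ nf inf dᵢ) (<A-fs-limPart nf inf d))

    <A-fs-limPart : ∀ {ζ x y} → NF ζ → isFinite ζ ≡ false → A (suc k) (fs (limPart ζ) x) y → x < y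
    <A-fs-limPart nf inf = <A-fs (limPart-NF nf) (limPart-Limit nf inf)

    <A-fs : ∀ {μ x y} → NF μ → Limit μ → A (suc k) (fs μ x) y → x < y
    <A-fs nfμ lμ d = ℕ.≤-<-trans (mc-fs nfμ lμ) (mc<A (fs-NF nfμ) d)

  2≤Aᵢ : ∀ {i ζ x} → NF ζ → isFinite ζ ≡ false → Aᵢ (suc k) (suc i) ζ x → 2 ≤ x
  2≤Aᵢ nf inf (Aˢ dᵢ d) =
    ℕ.≤-<-trans (ℕ.≤-trans (mc-pos nf (infinite⇒𝟎<ₒ inf)) (mc≤Aᵢ nf inf dᵢ)) (<A-fs-limPart nf inf d)

module _ (k : ℕ) where

  mutual
    A-fs<A : ∀ {ζ L n m p} → A (2 + k) ζ m → NF ζ → NF L → Limit L →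
             fs L n <ₒ ζ → ζ <ₒ L → A (2 + k) (fs L n) p → p < m
    A-fs<A (A-fin fin) nfζ _ _ lo _ dp with finite-below nfζ fin lo
    ... | fin′ , lt rewrite A-functional dp (A-fin fin′) = s≤s lt
    A-fs<A {ζ} (A-inf inf (Aˢ dᵢ d)) nfζ nfL lL lo hi dp with finPart ζ in fp
    ... | suc _ = ℕ.≤-<-trans (Aᵢ-fs≤ dᵢ nfζ inf fp nfL lL lo hi dp) (<A-fs-limPart (suc k) nfζ inf d)
    ... | zero with limPart ζ | limPart≡self nfζ fp | limPart-Limit nfζ inf
    ...   | _ | refl | lζ =
      A-fs<A d (fs-NF nfζ) nfL lL (bachmann nfL lL nfζ lζ lo hi (2≤Aᵢ (suc k) nfζ inf dᵢ))
        (<ₒ-trans (fs-<ₒ nfζ (Limit⇒𝟎<ₒ lζ)) hi) dp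

    Aᵢ-fs≤ : ∀ {i ζ x r L n p} → Aᵢ (2 + k) i ζ x → NF ζ → isFinite ζ ≡ false → finPart ζ ≡ suc r →
             NF L → Limit L → fs L n <ₒ ζ → ζ <ₒ L → A (2 + k) (fs L n) p → p ≤ x
    Aᵢ-fs≤ {ζ = ζ} (A⁰-succ _ d) nfζ _ fp nfL lL lo hi dp with finPart-suc⇒IsSucc ζ fp
    ... | sζ with <ₒ⇒≤ₒpred (fs-NF nfL) sζ lo
    ...   | inj₁ L[n]≡ζ-1 = ℕ.≤-reflexive (A-functional dp (subst (λ t → A (2 + k) t _) (sym L[n]≡ζ-1) d))
    ...   | inj₂ L[n]<ζ-1 = ℕ.<⇒≤ (A-fs<A d (pred-NF nfζ) nfL lL L[n]<ζ-1 (<ₒ-trans (pred-<ₒ sζ) hi) dp)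
    Aᵢ-fs≤ (A⁰-lim fp≡0) _ _ fp with trans (sym fp≡0) fp
    ... | ()
    Aᵢ-fs≤ (Aˢ dᵢ d) nfζ inf fp nfL lL lo hi dp =
      ℕ.≤-trans (Aᵢ-fs≤ dᵢ nfζ inf fp nfL lL lo hi dp) (ℕ.<⇒≤ (<A-fs-limPart (suc k) nfζ inf d))

corollary4p6 : (k : ℕ) → 2 ≤ k →
    (ξ λ' ζ : OT) (b : ℕ) →
    NF ξ → NF λ' → NF ζ → IsLimit λ' → ξ ≡ λ' +ℕ b →
    (∀ j → Aᵢ k (k ∸ 1) ξ j → fs λ' j <ₒ ζ) →
    ζ <ₒ λ' →
    ∀ m n → A k ζ m → A k ξ n → n < m
corollary4p6 (suc (suc k)) (s≤s (s≤s z≤n)) _ λ' ζ b _ nfλ nfζ isLim refl ⌊ξ⌋<ζ ζ<λ _ _ dζ (A-fin fin)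
  with trans (sym fin) (trans (isFinite-+ℕ λ' b) (Limit⇒infinite nfλ (IsLimit⇒Limit isLim)))
... | ()
corollary4p6 (suc (suc k)) (s≤s (s≤s z≤n)) _ λ' ζ b _ nfλ nfζ isLim refl ⌊ξ⌋<ζ ζ<λ _ n dζ (A-inf _ (Aˢ dᵢ d)) =
  A-fs<A k dζ nfζ nfλ lλ (⌊ξ⌋<ζ _ dᵢ) ζ<λ (subst (λ t → A _ (fs t _) n) (limPart-+ℕ nfλ lλ b) d)
  where
  lλ : Limit λ'
  lλ = IsLimit⇒Limit isLim
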